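{- For every nonnegative integer $a \neq 1$, \[\mathcal{G}_{\mathcal{E}}(2,a) = \begin{cases} a+2, & \text{if } a \equiv 0 \pmod 3,\\ a-3, & \text{if } a \equiv 1 \pmod 3,\\ a+1, & \text{if } a \equiv 2 \pmod 3. \end{cases}\]
   Context: A position is an unordered pair $(a,b)$ of nonnegative integers (pile sizes). $\mathcal{E}$-Wythoff: a move either removes a positive number of tokens from one pile, or removes the same positive number of tokens from both piles, or removes $k$ tokens from the smaller pile (or from either pile if the piles are equal) and $l$ tokens from the other pile, for integers $k \geq 1$, $l\ge 0$ with $l < k$. $\mathcal{G}_{\mathcal{E}}$ is its Sprague-Grundy function: $\mathcal{G}_{\mathcal{E}}(p)=\mathrm{mex}\{\mathcal{G}_{\mathcal{E}}(q): q \text{ reachable from } p \text{ in one move}\}$, where $\mathrm{mex}(S)$ is the least nonnegative integer not in $S$ and $\mathrm{mex}\{\}=0$. -}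

module Defs where

open import Data.Nat using (ℕ; zero; suc; _+_; _∸_; _≤ᵇ_; _<ᵇ_; _≡ᵇ_)
open import Data.Bool using (Bool; true; false; if_then_else_; _∧_)
open import Data.List using (List; []; _∷_; _++_; map; concatMap; filterᵇ; upTo)
open import Data.Bool.ListAction using (any)
open import Data.Product using (_×_; _,_; proj₁; proj₂)

range1 : ℕ → List ℕ
range1 n = map suc (upTo n)

moves : ℕ → ℕ → List (ℕ × ℕ)
moves x y =
     map (λ i → (x ∸ i , y)) (range1 x)
  ++ map (λ j → (x , y ∸ j)) (range1 y)
  ++ map (λ i → (x ∸ i , y ∸ i)) (filterᵇ (λ i → i ≤ᵇ y) (range1 x))
  ++ (if x ≤ᵇ y then smallFirst else [])
  ++ (if y ≤ᵇ x then smallSecond else [])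
  where
  smallFirst : List (ℕ × ℕ)
  smallFirst = concatMap (λ k → map (λ l → (x ∸ k , y ∸ l))
                                  (filterᵇ (λ l → l ≤ᵇ y) (upTo k)))
                         (range1 x)
  smallSecond : List (ℕ × ℕ)
  smallSecond = concatMap (λ k → map (λ l → (x ∸ l , y ∸ k))
                                   (filterᵇ (λ l → l ≤ᵇ x) (upTo k)))
                          (range1 y)

elemᵇ : ℕ → List ℕ → Bool
elemᵇ n xs = any (λ m → n ≡ᵇ m) xs

mexFrom : ℕ → ℕ → List ℕ → ℕ
mexFrom zero    n xs = n
mexFrom (suc f) n xs = if elemᵇ n xs then mexFrom f (suc n) xs else n

mex : List ℕ → ℕ
mex xs = mexFrom (suc (Data.List.length xs)) 0 xs

-- Grundy function with fuel; every move strictly decreases x + y, so fuel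
-- x + y + 1 suffices and the fuel never runs out in a genuine call.
Gfuel : ℕ → ℕ → ℕ → ℕ
Gfuel zero    x y = 0
Gfuel (suc f) x y = mex (map (λ p → Gfuel f (proj₁ p) (proj₂ p)) (moves x y))

GE : ℕ → ℕ → ℕ
GE x y = Gfuel (suc (x + y)) x y

-- We exhibit explicit candidate values g x y for the rows x = 0, 1, 2
-- (g 0 y = y, and periodic-with-shift-3 bijections g₁, g₂ on rows 1, 2)
-- and show that they satisfy the mex recursion; the theorem is then the
-- arithmetic identification of g₂ a with the three residue formulas.

module Submission where

open import Defs
open import Data.Nat using (ℕ; _+_; _∸_; _%_)
open import Relation.Binary.PropositionalEquality using (_≡_; _≢_)
open import Data.Product using (_×_)

open import Data.Nat using (zero; suc; _≤_; _<_; z≤n; s≤s; _≤ᵇ_; _≟_; _≤?_; _<?_)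
open import Data.Nat.Properties
open import Data.Nat.DivMod using ([m+n]%n≡m%n)
open import Data.Bool using (true; false; T?; if_then_else_)
open import Data.Bool.Properties using (T-≡; ¬-not)
open import Data.Fin using (Fin; toℕ)
open import Data.Fin.Properties using (pigeonhole; toℕ<n)
open import Data.List using (List; []; _∷_; _++_; map; concatMap; filterᵇ; length; lookup; upTo)
open import Data.List.Properties using (map-cong-local)
open import Data.List.Membership.Propositional using (_∈_; _∉_)
open import Data.List.Membership.Propositional.Properties
  using (∈-map⁺; ∈-map⁻; ∈-++⁺ˡ; ∈-++⁺ʳ; ∈-++⁻; ∈-upTo⁺; ∈-upTo⁻)
open import Data.List.Membership.DecPropositional _≟_ using (_∈?_)
open import Data.List.Relation.Unary.Any using (index)
open import Data.List.Relation.Unary.Any.Properties using (any⁺; any⁻; lookup-index)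
import Data.List.Relation.Unary.Any as Any
open import Data.List.Relation.Unary.All as All using (All; []; _∷_)
import Data.List.Relation.Unary.All.Properties as AllP
open import Data.Product using (_,_; proj₁; proj₂; ∃)
open import Data.Sum using (_⊎_; inj₁; inj₂)
open import Data.Empty using (⊥-elim)
open import Function using (_∘_; Equivalence)
open import Relation.Nullary using (yes; no)
open import Relation.Nullary.Decidable using (_⊎-dec_; toWitness; from-no)
open import Relation.Unary using (Decidable)
open import Relation.Binary.PropositionalEquality using (refl; sym; trans; cong; subst)

elemᵇ-∈ : ∀ {n xs} → n ∈ xs → elemᵇ n xs ≡ true
elemᵇ-∈ {n} n∈ = Equivalence.to T-≡ (any⁺ _ (Any.map (≡⇒≡ᵇ n _) n∈))

elemᵇ-∉ : ∀ {n xs} → n ∉ xs → elemᵇ n xs ≡ false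
elemᵇ-∉ {n} {xs} n∉ = ¬-not (λ e → n∉ (Any.map (≡ᵇ⇒≡ n _) (any⁻ _ xs (Equivalence.from T-≡ e))))

covered⇒≤length : ∀ m xs → (∀ k → k < m → k ∈ xs) → m ≤ length xs
covered⇒≤length m xs cov with m ≤? length xs
... | yes m≤len = m≤len
... | no m≰len =
  let (i , j , i<j , same) = pigeonhole (≰⇒> m≰len) position in
  ⊥-elim (<-irrefl (trans (found i) (trans (cong (lookup xs) same) (sym (found j)))) i<j)
  where
  position : Fin m → Fin (length xs)
  position i = index (cov (toℕ i) (toℕ<n i))

  found : ∀ i → toℕ i ≡ lookup xs (position i)
  found i = lookup-index (cov (toℕ i) (toℕ<n i))

mexFrom-spec : ∀ f n m xs → n ≤ m → m ≤ f + n →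
               (∀ k → n ≤ k → k < m → k ∈ xs) → m ∉ xs → mexFrom f n xs ≡ m
mexFrom-spec zero    n m xs n≤m m≤n _   _  = ≤-antisym n≤m m≤n
mexFrom-spec (suc f) n m xs n≤m m≤f+n cov m∉ with n ≟ m
... | yes refl rewrite elemᵇ-∉ m∉ = refl
... | no n≢m rewrite elemᵇ-∈ (cov n ≤-refl (≤∧≢⇒< n≤m n≢m)) =
  mexFrom-spec f (suc n) m xs (≤∧≢⇒< n≤m n≢m) (subst (m ≤_) (sym (+-suc f n)) m≤f+n)
    (λ k n<k → cov k (<⇒≤ n<k)) m∉

mex-spec : ∀ xs m → (∀ k → k < m → k ∈ xs) → m ∉ xs → mex xs ≡ m
mex-spec xs m cov m∉ = mexFrom-spec (suc (length xs)) 0 m xs z≤n fuel (λ k _ → cov k) m∉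
  where
  fuel : m ≤ suc (length xs) + 0
  fuel = ≤-trans (covered⇒≤length m xs cov)
                 (≤-trans (n≤1+n _) (≤-reflexive (sym (+-identityʳ _))))

_≺_ : ℕ × ℕ → ℕ × ℕ → Set
p ≺ q = proj₁ p ≤ proj₁ q × proj₂ p ≤ proj₂ q × proj₁ p + proj₂ p < proj₁ q + proj₂ q

remove-first : ∀ {x i} y j → 0 < i → i ≤ x → (x ∸ i , y ∸ j) ≺ (x , y)
remove-first {x} {i} y j 0<i i≤x =
  m∸n≤m x i , m∸n≤m y j , +-mono-<-≤ (∸-monoʳ-< 0<i i≤x) (m∸n≤m y j)

remove-second : ∀ x i {y j} → 0 < j → j ≤ y → (x ∸ i , y ∸ j) ≺ (x , y)
remove-second x i {y} {j} 0<j j≤y =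
  m∸n≤m x i , m∸n≤m y j , +-mono-≤-< (m∸n≤m x i) (∸-monoʳ-< 0<j j≤y)

range1-bounds : ∀ n → All (λ i → 0 < i × i ≤ n) (range1 n)
range1-bounds n = AllP.map⁺ (All.tabulate (λ i∈ → s≤s z≤n , ∈-upTo⁻ i∈))

All-if : ∀ {A : Set} {P : A → Set} b {xs : List A} → All P xs → All P (if b then xs else [])
All-if true  ps = ps
All-if false _  = []

-- Every E-Wythoff move shrinks the position: it removes k ≥ 1 tokens from
-- one pile and some l (possibly 0) from the other.
moves-shrink : ∀ x y → All (_≺ (x , y)) (moves x y)
moves-shrink x y =
  AllP.++⁺ firstPile (AllP.++⁺ secondPile (AllP.++⁺ bothPiles
    (AllP.++⁺ (All-if (x ≤ᵇ y) firstSmaller) (All-if (y ≤ᵇ x) secondSmaller))))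
  where
  fromFirst : ∀ {Q : ℕ → Set} → (∀ {i} → 0 < i → i ≤ x → Q i) → All Q (range1 x)
  fromFirst q = All.map (λ (0<i , i≤x) → q 0<i i≤x) (range1-bounds x)

  fromSecond : ∀ {Q : ℕ → Set} → (∀ {j} → 0 < j → j ≤ y → Q j) → All Q (range1 y)
  fromSecond q = All.map (λ (0<j , j≤y) → q 0<j j≤y) (range1-bounds y)

  firstPile : All (_≺ (x , y)) (map (λ i → (x ∸ i , y)) (range1 x))
  firstPile = AllP.map⁺ (fromFirst (remove-first y 0))

  secondPile : All (_≺ (x , y)) (map (λ j → (x , y ∸ j)) (range1 y))
  secondPile = AllP.map⁺ (fromSecond (remove-second x 0))

  bothPiles : All (_≺ (x , y)) (map (λ i → (x ∸ i , y ∸ i)) (filterᵇ (_≤ᵇ y) (range1 x)))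
  bothPiles = AllP.map⁺ (AllP.filter⁺ (T? ∘ (_≤ᵇ y)) (fromFirst (λ {i} → remove-first y i)))

  firstSmaller : All (_≺ (x , y))
    (concatMap (λ k → map (λ l → (x ∸ k , y ∸ l)) (filterᵇ (_≤ᵇ y) (upTo k))) (range1 x))
  firstSmaller = AllP.concat⁺ (AllP.map⁺ (fromFirst (λ {k} 0<k k≤x →
    AllP.map⁺ (AllP.filter⁺ (T? ∘ (_≤ᵇ y)) (All.universal (λ l → remove-first y l 0<k k≤x) (upTo k))))))

  secondSmaller : All (_≺ (x , y))
    (concatMap (λ k → map (λ l → (x ∸ l , y ∸ k)) (filterᵇ (_≤ᵇ x) (upTo k))) (range1 y))
  secondSmaller = AllP.concat⁺ (AllP.map⁺ (fromSecond (λ {k} 0<k k≤y →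
    AllP.map⁺ (AllP.filter⁺ (T? ∘ (_≤ᵇ x)) (All.universal (λ l → remove-second x l 0<k k≤y) (upTo k))))))

value : (ℕ → ℕ → ℕ) → ℕ × ℕ → ℕ
value h p = h (proj₁ p) (proj₂ p)

module GrundyOn (C : ℕ → ℕ → Set)
                (C-down : ∀ {x y a b} → a ≤ x → b ≤ y → C x y → C a b)
                (h : ℕ → ℕ → ℕ)
                (h-mex : ∀ {x y} → C x y → mex (map (value h) (moves x y)) ≡ h x y) where

  Gfuel-agrees : ∀ f {x y} → C x y → x + y < f → Gfuel f x y ≡ h x y
  Gfuel-agrees (suc f) {x} {y} c x+y<f =
    trans (cong mex (map-cong-local (All.map agree (moves-shrink x y)))) (h-mex c)
    where
    agree : ∀ {p} → p ≺ (x , y) → Gfuel f (proj₁ p) (proj₂ p) ≡ value h p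
    agree (a≤x , b≤y , smaller) = Gfuel-agrees f (C-down a≤x b≤y c) (<-≤-trans smaller (≤-pred x+y<f))

  GE-agrees : ∀ {x y} → C x y → GE x y ≡ h x y
  GE-agrees {x} {y} c = Gfuel-agrees (suc (x + y)) c ≤-refl

rowMoves : ℕ → ℕ → List (ℕ × ℕ)
rowMoves x y = map (λ j → (x , y ∸ j)) (range1 y)

rowMoves-complete : ∀ {x y b} → b < y → (x , b) ∈ rowMoves x y
rowMoves-complete {x} {y} {b} b<y =
  subst (λ c → (x , c) ∈ rowMoves x y) (m∸[m∸n]≡n (<⇒≤ b<y))
    (∈-map⁺ (λ j → (x , y ∸ j)) (subst (_∈ range1 y) (sym (+-∸-assoc 1 b<y))
      (∈-map⁺ suc (∈-upTo⁺ (∸-monoʳ-< (s≤s z≤n) b<y)))))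

rowMoves-sound : ∀ {x y p} → p ∈ rowMoves x y → ∃ λ b → b < y × p ≡ (x , b)
rowMoves-sound {x} {y} p∈ with ∈-map⁻ (λ j → (x , y ∸ j)) p∈
... | j , j∈ , refl with ∈-map⁻ suc j∈
...   | i , i∈ , refl = y ∸ suc i , ∸-monoʳ-< (s≤s z≤n) (∈-upTo⁻ i∈) , refl

-- Suppose the moves from (x , y) are the row moves plus the positions
-- front ++ rest, and h x is a bijection with inverse r⁻¹.  Then the row
-- moves realise exactly the values k with r⁻¹ k < y, so h x y is the mex
-- once the remaining values below it are supplied by front ++ rest, and
-- h x y itself is not.
row-mex : (h : ℕ → ℕ → ℕ) (r⁻¹ : ℕ → ℕ) {x y : ℕ} (front rest : List (ℕ × ℕ)) →
          moves x y ≡ front ++ rowMoves x y ++ rest →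
          (∀ b → r⁻¹ (h x b) ≡ b) → (∀ k → h x (r⁻¹ k) ≡ k) →
          (∀ {k} → k < h x y → k ∈ map (value h) (front ++ rest) ⊎ r⁻¹ k < y) →
          h x y ∉ map (value h) (front ++ rest) →
          mex (map (value h) (moves x y)) ≡ h x y
row-mex h r⁻¹ {x} {y} front rest split left right cover fresh =
  trans (cong (mex ∘ map (value h)) split) (mex-spec _ _ reached unreached)
  where
  allMoves : List (ℕ × ℕ)
  allMoves = front ++ rowMoves x y ++ rest

  other⇒move : ∀ {p} → p ∈ front ++ rest → p ∈ allMoves
  other⇒move p∈ with ∈-++⁻ front p∈
  ... | inj₁ p∈f = ∈-++⁺ˡ p∈f
  ... | inj₂ p∈r = ∈-++⁺ʳ front (∈-++⁺ʳ (rowMoves x y) p∈r)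

  move⇒row⊎other : ∀ {p} → p ∈ allMoves → p ∈ rowMoves x y ⊎ p ∈ front ++ rest
  move⇒row⊎other p∈ with ∈-++⁻ front p∈
  ... | inj₁ p∈f = inj₂ (∈-++⁺ˡ p∈f)
  ... | inj₂ p∈mr with ∈-++⁻ (rowMoves x y) p∈mr
  ...   | inj₁ p∈m = inj₁ p∈m
  ...   | inj₂ p∈r = inj₂ (∈-++⁺ʳ front p∈r)

  reached : ∀ k → k < h x y → k ∈ map (value h) allMoves
  reached k k< with cover k<
  ... | inj₁ k∈ with ∈-map⁻ (value h) k∈
  ...   | p , p∈ , refl = ∈-map⁺ (value h) (other⇒move p∈)
  reached k k< | inj₂ r⁻¹k<y = subst (_∈ map (value h) allMoves) (right k)
    (∈-map⁺ (value h) (∈-++⁺ʳ front (∈-++⁺ˡ (rowMoves-complete r⁻¹k<y))))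

  unreached : h x y ∉ map (value h) allMoves
  unreached v∈ with ∈-map⁻ (value h) v∈
  ... | p , p∈ , e with move⇒row⊎other p∈
  ...   | inj₂ p∈o = fresh (subst (_∈ map (value h) (front ++ rest)) (sym e) (∈-map⁺ (value h) p∈o))
  ...   | inj₁ p∈m with rowMoves-sound p∈m
  ...     | b , b<y , refl =
    <-irrefl (trans (sym (left b)) (trans (cong r⁻¹ (sym e)) (left y))) b<y

shift-∈ : ∀ {k xs} → 3 + k ∈ map (3 +_) xs → k ∈ xs
shift-∈ {k} 3+k∈ with ∈-map⁻ (3 +_) 3+k∈
... | k′ , k′∈ , e = subst (_∈ _) (sym (+-cancelˡ-≡ 3 k k′ e)) k′∈

g₁ : ℕ → ℕ
g₁ 0 = 1
g₁ 1 = 2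
g₁ 2 = 0
g₁ (suc (suc (suc n))) = 3 + g₁ n

g₁⁻¹ : ℕ → ℕ
g₁⁻¹ 0 = 2
g₁⁻¹ 1 = 0
g₁⁻¹ 2 = 1
g₁⁻¹ (suc (suc (suc n))) = 3 + g₁⁻¹ n

g₂ : ℕ → ℕ
g₂ 0 = 2
g₂ 1 = 0
g₂ 2 = 3
g₂ 3 = 5
g₂ 4 = 1
g₂ (suc (suc (suc (suc (suc n))))) = 3 + g₂ (suc (suc n))

g₂⁻¹ : ℕ → ℕ
g₂⁻¹ 0 = 1
g₂⁻¹ 1 = 4
g₂⁻¹ 2 = 0
g₂⁻¹ 3 = 2
g₂⁻¹ (suc (suc (suc (suc k)))) = 3 + g₂⁻¹ (suc k)

g₁⁻¹∘g₁ : ∀ y → g₁⁻¹ (g₁ y) ≡ y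
g₁⁻¹∘g₁ 0 = refl
g₁⁻¹∘g₁ 1 = refl
g₁⁻¹∘g₁ 2 = refl
g₁⁻¹∘g₁ (suc (suc (suc n))) = cong (3 +_) (g₁⁻¹∘g₁ n)

g₁∘g₁⁻¹ : ∀ k → g₁ (g₁⁻¹ k) ≡ k
g₁∘g₁⁻¹ 0 = refl
g₁∘g₁⁻¹ 1 = refl
g₁∘g₁⁻¹ 2 = refl
g₁∘g₁⁻¹ (suc (suc (suc k))) = cong (3 +_) (g₁∘g₁⁻¹ k)

g₂⁻¹∘g₂ : ∀ y → g₂⁻¹ (g₂ y) ≡ y
g₂⁻¹∘g₂ 0 = refl
g₂⁻¹∘g₂ 1 = refl
g₂⁻¹∘g₂ 2 = refl
g₂⁻¹∘g₂ 3 = refl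
g₂⁻¹∘g₂ 4 = refl
g₂⁻¹∘g₂ 5 = refl
g₂⁻¹∘g₂ 6 = refl
g₂⁻¹∘g₂ 7 = refl
g₂⁻¹∘g₂ (suc (suc (suc (suc (suc (suc (suc (suc n)))))))) =
  cong (3 +_) (g₂⁻¹∘g₂ (suc (suc (suc (suc (suc n))))))

g₂∘g₂⁻¹ : ∀ k → g₂ (g₂⁻¹ k) ≡ k
g₂∘g₂⁻¹ 0 = refl
g₂∘g₂⁻¹ 1 = refl
g₂∘g₂⁻¹ 2 = refl
g₂∘g₂⁻¹ 3 = refl
g₂∘g₂⁻¹ 4 = refl
g₂∘g₂⁻¹ 5 = refl
g₂∘g₂⁻¹ 6 = refl
g₂∘g₂⁻¹ (suc (suc (suc (suc (suc (suc (suc k))))))) =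
  cong (3 +_) (g₂∘g₂⁻¹ (suc (suc (suc (suc k)))))

-- The claimed Grundy values on rows 0, 1 and 2.
g : ℕ → ℕ → ℕ
g 0 y = y
g 1 y = g₁ y
g 2 y = g₂ y
g _ _ = 0

-- Values of the moves from (1 , 2 + n) that leave row 1.
reach₁ : ℕ → List ℕ
reach₁ n = 2 + n ∷ 1 + n ∷ 2 + n ∷ []

-- k is a move value from (1 , 2 + n): it leaves the row, or it is the
-- value of the row move to the inverse image of k.
Covered₁ : ℕ → ℕ → Set
Covered₁ n k = k ∈ reach₁ n ⊎ g₁⁻¹ k < 2 + n

covered₁? : ∀ n → Decidable (Covered₁ n)
covered₁? n k = (k ∈? reach₁ n) ⊎-dec (g₁⁻¹ k <? 2 + n)

-- Every value below g₁ (2 + n) is reached: small windows by evaluation, the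
-- rest by periodicity (shifting n and k by 3).
cover₁ : ∀ n {k} → k < g₁ (2 + n) → Covered₁ n k
cover₁ 0 = toWitness {a? = allUpTo? (covered₁? 0) (g₁ 2)} _
cover₁ 1 = toWitness {a? = allUpTo? (covered₁? 1) (g₁ 3)} _
cover₁ 2 = toWitness {a? = allUpTo? (covered₁? 2) (g₁ 4)} _
cover₁ (suc (suc (suc n))) {0} _ = inj₂ (s≤s (s≤s (s≤s z≤n)))
cover₁ (suc (suc (suc n))) {1} _ = inj₂ (s≤s z≤n)
cover₁ (suc (suc (suc n))) {2} _ = inj₂ (s≤s (s≤s z≤n))
cover₁ (suc (suc (suc n))) {suc (suc (suc k))} (s≤s (s≤s (s≤s k<))) with cover₁ n k<
... | inj₁ k∈ = inj₁ (∈-map⁺ (3 +_) k∈)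
... | inj₂ t  = inj₂ (+-monoʳ-< 3 t)

fresh₁ : ∀ n → g₁ (2 + n) ∉ reach₁ n
fresh₁ 0 = from-no (g₁ 2 ∈? reach₁ 0)
fresh₁ 1 = from-no (g₁ 3 ∈? reach₁ 1)
fresh₁ 2 = from-no (g₁ 4 ∈? reach₁ 2)
fresh₁ (suc (suc (suc n))) v∈ = fresh₁ n (shift-∈ v∈)

-- Values of the moves from (2 , 3 + n) that leave row 2.
reach₂ : ℕ → List ℕ
reach₂ n = g₁ (3 + n) ∷ 3 + n ∷ g₁ (2 + n) ∷ 1 + n ∷ g₁ (3 + n) ∷ 3 + n ∷ 2 + n ∷ []

-- k is a move value from (2 , 3 + n): it leaves the row, or it is the
-- value of the row move to the inverse image of k.
Covered₂ : ℕ → ℕ → Set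
Covered₂ n k = k ∈ reach₂ n ⊎ g₂⁻¹ k < 3 + n

covered₂? : ∀ n → Decidable (Covered₂ n)
covered₂? n k = (k ∈? reach₂ n) ⊎-dec (g₂⁻¹ k <? 3 + n)

-- Every value below g₂ (3 + n) is reached: small windows by evaluation, the
-- rest by periodicity (shifting n and k by 3).
cover₂ : ∀ n {k} → k < g₂ (3 + n) → Covered₂ n k
cover₂ 0 = toWitness {a? = allUpTo? (covered₂? 0) (g₂ 3)} _
cover₂ 1 = toWitness {a? = allUpTo? (covered₂? 1) (g₂ 4)} _
cover₂ 2 = toWitness {a? = allUpTo? (covered₂? 2) (g₂ 5)} _
cover₂ (suc (suc (suc n))) {0} _ = inj₂ (s≤s (s≤s z≤n))
cover₂ (suc (suc (suc n))) {1} _ = inj₂ (s≤s (s≤s (s≤s (s≤s (s≤s z≤n)))))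
cover₂ (suc (suc (suc n))) {2} _ = inj₂ (s≤s z≤n)
cover₂ (suc (suc (suc n))) {3} _ = inj₂ (s≤s (s≤s (s≤s z≤n)))
cover₂ (suc (suc (suc n))) {suc (suc (suc (suc k)))} (s≤s (s≤s (s≤s k<))) with cover₂ n k<
... | inj₁ k∈ = inj₁ (∈-map⁺ (3 +_) k∈)
... | inj₂ t  = inj₂ (+-monoʳ-< 3 t)

fresh₂ : ∀ n → g₂ (3 + n) ∉ reach₂ n
fresh₂ 0 = from-no (g₂ 3 ∈? reach₂ 0)
fresh₂ 1 = from-no (g₂ 4 ∈? reach₂ 1)
fresh₂ 2 = from-no (g₂ 5 ∈? reach₂ 2)
fresh₂ (suc (suc (suc n))) v∈ = fresh₂ n (shift-∈ v∈)

-- The candidate satisfies the mex recursion on rows 0, 1 and 2; the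
-- positions with both piles tiny are settled by evaluation.
g-mex : ∀ {x y} → x ≤ 2 → mex (map (value g) (moves x y)) ≡ g x y
g-mex {0} {0} _ = refl
g-mex {0} {suc n} _ =
  row-mex g (λ k → k) {0} {suc n} [] [] refl (λ _ → refl) (λ _ → refl) inj₂ (λ ())
g-mex {1} {0} _ = refl
g-mex {1} {1} _ = refl
g-mex {1} {suc (suc n)} _ =
  row-mex g g₁⁻¹ {1} {2 + n} ((0 , 2 + n) ∷ []) ((0 , 1 + n) ∷ (0 , 2 + n) ∷ []) refl
    g₁⁻¹∘g₁ g₁∘g₁⁻¹ (cover₁ n) (fresh₁ n)
g-mex {2} {0} _ = refl
g-mex {2} {1} _ = refl
g-mex {2} {2} _ = refl
g-mex {2} {suc (suc (suc n))} _ =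
  row-mex g g₂⁻¹ {2} {3 + n} ((1 , 3 + n) ∷ (0 , 3 + n) ∷ [])
    ((1 , 2 + n) ∷ (0 , 1 + n) ∷ (1 , 3 + n) ∷ (0 , 3 + n) ∷ (0 , 2 + n) ∷ []) refl
    g₂⁻¹∘g₂ g₂∘g₂⁻¹ (cover₂ n) (fresh₂ n)
g-mex {suc (suc (suc _))} (s≤s (s≤s ()))

open GrundyOn (λ x _ → x ≤ 2) (λ a≤x _ x≤2 → ≤-trans a≤x x≤2) g g-mex

GE-row₂ : ∀ a → GE 2 a ≡ g₂ a
GE-row₂ a = GE-agrees {2} {a} ≤-refl

mod3-shift : ∀ a → (3 + a) % 3 ≡ a % 3
mod3-shift a = trans (cong (_% 3) (+-comm 3 a)) ([m+n]%n≡m%n a 3)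

-- g₂ agrees with the closed form on each residue class (induction with
-- period 3; for a ≡ 1 the closed form a - 3 is stated as 3 + g₂ a ≡ a).
g₂-0mod3 : ∀ a → a % 3 ≡ 0 → g₂ a ≡ a + 2
g₂-0mod3 0 _ = refl
g₂-0mod3 1 ()
g₂-0mod3 2 ()
g₂-0mod3 3 _ = refl
g₂-0mod3 4 ()
g₂-0mod3 (suc (suc (suc (suc (suc a))))) r =
  cong (3 +_) (g₂-0mod3 (suc (suc a)) (trans (sym (mod3-shift (suc (suc a)))) r))

g₂-1mod3 : ∀ a → a ≢ 1 → a % 3 ≡ 1 → 3 + g₂ a ≡ a
g₂-1mod3 0 _ ()
g₂-1mod3 1 a≢1 _ = ⊥-elim (a≢1 refl)
g₂-1mod3 2 _ ()
g₂-1mod3 3 _ ()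
g₂-1mod3 4 _ _ = refl
g₂-1mod3 (suc (suc (suc (suc (suc a))))) _ r =
  cong (3 +_) (g₂-1mod3 (suc (suc a)) (λ ()) (trans (sym (mod3-shift (suc (suc a)))) r))

g₂-2mod3 : ∀ a → a % 3 ≡ 2 → g₂ a ≡ a + 1
g₂-2mod3 0 ()
g₂-2mod3 1 ()
g₂-2mod3 2 _ = refl
g₂-2mod3 3 ()
g₂-2mod3 4 ()
g₂-2mod3 (suc (suc (suc (suc (suc a))))) r =
  cong (3 +_) (g₂-2mod3 (suc (suc a)) (trans (sym (mod3-shift (suc (suc a)))) r))

lemma3p6 : (a : ℕ) → a ≢ 1 →
    (a % 3 ≡ 0 → GE 2 a ≡ a + 2) ×
    (a % 3 ≡ 1 → GE 2 a ≡ a ∸ 3) ×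
    (a % 3 ≡ 2 → GE 2 a ≡ a + 1)
lemma3p6 a a≢1 =
  (λ r → trans (GE-row₂ a) (g₂-0mod3 a r)) ,
  (λ r → trans (GE-row₂ a) (trans (sym (m+n∸m≡n 3 (g₂ a))) (cong (_∸ 3) (g₂-1mod3 a a≢1 r)))) ,
  (λ r → trans (GE-row₂ a) (g₂-2mod3 a r))
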